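{- Let $a_1,a_2,a_3,a_4$ be positive integers with $(a_1,a_2,a_3)=1$. Let $p_{1,2},p_{1,3},p_{1,4},p_{2,3},p_{2,4},p_{3,4}$ be pairwise distinct primes such that $p_{1,4}\nmid a_1$, $p_{2,4}\nmid a_2$, $p_{3,4}\nmid a_3$, $p_{1,2}\nmid(a_1,a_2)$, $p_{1,3}\nmid(a_1,a_3)$, $p_{2,3}\nmid(a_2,a_3)$. Then every positive integer \[ n\ge a_3 p_{1,2} p_{1,4} p_{2,4} + a_4 p_{1,2} p_{1,3} p_{2,3} + \tfrac{a_1a_2}{(a_1,a_2)} p_{1,3} p_{1,4} p_{2,3} p_{2,4} p_{3,4} + 2 \tfrac{a_1 a_3}{(a_1,a_3)} p_{1,2} p_{1,4} p_{2,3} p_{2,4} p_{3,4} + 2 \tfrac{a_2 a_3}{(a_2,a_3)} p_{1,2} p_{1,3} p_{1,4} p_{2,4} p_{3,4} \] can be written as $n=a_1\mu_1+a_2\mu_2+a_3\mu_3+a_4\mu_4$ with positive integers $\mu_1,\ldots,\mu_4$ such that $(\mu_1,\mu_2,\mu_3,\mu_4)=1$ and $(\mu_i,\mu_j)>1$ for all $i,j\in\{1,2,3,4\}$.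
   Context: $(b_1,\ldots,b_k)$ denotes the greatest common divisor. -}

module Defs where

open import Data.Nat using (ℕ; _+_; _*_)
open import Data.Nat.GCD using (gcd)
open import Data.Nat.LCM using (lcm)

gcd₃ : ℕ → ℕ → ℕ → ℕ
gcd₃ a b c = gcd (gcd a b) c

gcd₄ : ℕ → ℕ → ℕ → ℕ → ℕ
gcd₄ a b c d = gcd (gcd (gcd a b) c) d

-- the bound of the theorem; a_i a_j / (a_i,a_j) is lcm a_i a_j (a_i > 0)
bound : (a₁ a₂ a₃ a₄ p₁₂ p₁₃ p₁₄ p₂₃ p₂₄ p₃₄ : ℕ) → ℕ
bound a₁ a₂ a₃ a₄ p₁₂ p₁₃ p₁₄ p₂₃ p₂₄ p₃₄ =
  a₃ * p₁₂ * p₁₄ * p₂₄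
  + a₄ * p₁₂ * p₁₃ * p₂₃
  + lcm a₁ a₂ * p₁₃ * p₁₄ * p₂₃ * p₂₄ * p₃₄
  + 2 * lcm a₁ a₃ * p₁₂ * p₁₄ * p₂₃ * p₂₄ * p₃₄
  + 2 * lcm a₂ a₃ * p₁₂ * p₁₃ * p₁₄ * p₂₄ * p₃₄

{-# OPTIONS --safe #-}
module Submission where

-- Take μᵢ = xᵢ · ∏ {p_jk : i ∉ {j,k}} for i ≤ 3 and μ₄ = p₁₂ p₁₃ p₂₃. Any two of the μᵢ
-- share a prime p_jk, and since the p_jk are distinct, (μ₁,…,μ₄) = 1 amounts to
-- p₁₂ ∤ (x₁,x₂), p₁₃ ∤ (x₁,x₃) and p₂₃ ∤ (x₂,x₃). With bᵢ = aᵢ · ∏ {p_jk : i ∉ {j,k}} it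
-- remains to write m = n − a₄μ₄ as b₁x₁ + b₂x₂ + b₃x₃ with positive xᵢ subject to these
-- three conditions. The hypotheses give (b₁,b₂,b₃) = 1, so there is an integer solution,
-- which we move along the kernel vectors (b₂,−b₁,0), (u₁₃,0,−w₁₃) and (0,u₂₃,−w₂₃), where
-- b₁u₁₃ = b₃w₁₃ and b₂u₂₃ = b₃w₂₃: if a prime divides both entries of a solution but not
-- both entries of the vector, one step along the vector separates them. First separate
-- x₁, x₂ at p₁₂; then reduce x₁ into [1, u₁₃] and x₂ into [1, u₂₃], which keeps that
-- condition because p₁₂ divides u₁₃ and u₂₃; then at most one more step in each of the
-- last two directions separates at p₁₃ and at p₂₃ without undoing the earlier steps. Now
-- b₁x₁ + b₂x₂ ≤ 2b₁u₁₃ + 2b₂u₂₃, which the bound on n keeps below m, so x₃ > 0.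

open import Defs
open import Data.Nat.Base
  using (ℕ; zero; suc; NonZero; _∸_; _≤_; _<_; nonTrivial⇒n>1; ≢-nonZero; ≢-nonZero⁻¹; >-nonZero; >-nonZero⁻¹)
import Data.Nat.Properties as ℕ
open import Data.Nat.Divisibility using (_∣_; ∣-trans; ∣1⇒≡1; ∣⇒≤; m∣m*n; n∣m*n; n∣m*n*o; ∣m⇒∣m*n)
open import Data.Nat.DivMod using (_/_; *-/-assoc)
open import Data.Nat.GCD using (gcd; gcd[m,n]∣m; gcd[m,n]∣n; gcd[m,n]≢0; gcd-greatest; n/gcd[m,n]≢0)
open import Data.Nat.LCM using (lcm)
open import Data.Nat.Coprimality using (coprime-/gcd)
open import Data.Nat.Primality using (Prime; euclidsLemma; prime⇒irreducible; prime⇒nonZero; prime⇒nonTrivial)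
open import Data.Nat.Primality.Factorisation using (factorise)
open import Data.List.Base using (_∷_; [])
open import Data.List.Relation.Unary.All using ([]; _∷_)
open import Data.List.Relation.Unary.AllPairs using ([]; _∷_)
open import Data.List.Relation.Unary.Unique.Propositional using (Unique)
open import Data.Product using (Σ; _×_; _,_; proj₁; proj₂)
open import Data.Sum using (_⊎_; inj₁; inj₂; [_,_]; map₂)
open import Data.Empty using (⊥; ⊥-elim)
open import Function.Base using (id; _∘_; _$_)
open import Relation.Nullary using (¬_; yes; no)
open import Relation.Binary.PropositionalEquality
  using (_≡_; _≢_; refl; sym; trans; cong; cong₂; subst; ≢-sym; module ≡-Reasoning)

module LinearDiophantine where

  open import Data.Integer.Base using (ℤ; +_; -[1+_]; _+_; _-_; _*_; -_)
  open import Data.Integer.Properties using (pos-+; pos-*; +-injective; ∣-i∣≡∣i∣; *-identityˡ)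
  import Data.Integer.Divisibility.Signed as Signed
  open import Data.Integer.DivMod using (_%ℕ_; _/ℕ_; n%ℕd<d; a≡a%ℕn+[a/ℕn]*n)
  open import Data.Integer.Tactic.RingSolver using (solve-∀)
  open import Data.Nat.Base as ℕ using (_≤_; _<_; z<s)
  import Data.Nat.Properties as ℕ
  open import Data.Nat.Divisibility using (_∣_)
  open import Data.Nat.GCD using (gcd; gcd-GCD; module Bézout)
  open import Data.Nat.Coprimality using (coprime-Bézout; gcd≡1⇒coprime)
  open ≡-Reasoning

  infix 4 _∣ℤ_
  _∣ℤ_ : ℕ → ℤ → Set
  q ∣ℤ x = + q Signed.∣ x

  NotCommonDivisor : ℕ → ℤ → ℤ → Set
  NotCommonDivisor q x y = ¬ (q ∣ℤ x × q ∣ℤ y)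

  ∣ℤ-+⇒∣ℤ : ∀ {q d x} → q ∣ d → q ∣ℤ x + + d → q ∣ℤ x
  ∣ℤ-+⇒∣ℤ q∣d q∣x+d = Signed.∣m+n∣n⇒∣m q∣x+d (Signed.∣ᵤ⇒∣ q∣d)

  ∣ℤ--⇒∣ℤ : ∀ {q d x} → q ∣ d → q ∣ℤ x - + d → q ∣ℤ x
  ∣ℤ--⇒∣ℤ q∣d q∣x-d = Signed.∣m+n∣n⇒∣m q∣x-d (Signed.∣m⇒∣-m (Signed.∣ᵤ⇒∣ q∣d))

  ∣ℤ⇒∣ℤ-+* : ∀ {q d x} k → q ∣ d → q ∣ℤ x → q ∣ℤ x + k * + d
  ∣ℤ⇒∣ℤ-+* k q∣d q∣x = Signed.∣m∣n⇒∣m+n q∣x (Signed.∣n⇒∣m*n k (Signed.∣ᵤ⇒∣ q∣d))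

  separate : ∀ q {u w} → ¬ (q ∣ u × q ∣ w) → ∀ x y →
             NotCommonDivisor q x y ⊎ NotCommonDivisor q (x + + u) (y - + w)
  separate q q∤u,w x y with + q Signed.∣? x | + q Signed.∣? y
  ... | no q∤x | _ = inj₁ λ (q∣x , _) → q∤x q∣x
  ... | yes _ | no q∤y = inj₁ λ (_ , q∣y) → q∤y q∣y
  ... | yes q∣x | yes q∣y = inj₂ λ (q∣x+u , q∣y-w) → q∤u,w
    ( Signed.∣⇒∣ᵤ (Signed.∣m+n∣m⇒∣n q∣x+u q∣x)
    , subst (q ∣_) (∣-i∣≡∣i∣ (+ _)) (Signed.∣⇒∣ᵤ (Signed.∣m+n∣m⇒∣n q∣y-w q∣y)) )

  positive-residue : ∀ u .{{_ : NonZero u}} x → Σ ℕ λ z → z < u × Σ ℤ λ k → x ≡ + suc z + k * + u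
  positive-residue u x = r , n%ℕd<d (x - + 1) u , k , (begin
      x                            ≡⟨ shift x ⟩
      + 1 + (x - + 1)              ≡⟨ cong (λ y → + 1 + y) (a≡a%ℕn+[a/ℕn]*n (x - + 1) u) ⟩
      + 1 + (+ r + k * + u)        ≡⟨ reassociate (+ r) k (+ u) ⟩
      + suc r + k * + u            ∎)
    where
    r = (x - + 1) %ℕ u
    k = (x - + 1) /ℕ u
    shift : ∀ x → x ≡ + 1 + (x - + 1)
    shift = solve-∀
    reassociate : ∀ r k u → + 1 + (r + k * u) ≡ (+ 1 + r) + k * u
    reassociate = solve-∀

  bézout-ℤ : ∀ {d m n} → Bézout.Identity d m n → Σ ℤ λ α → Σ ℤ λ β → + m * α + + n * β ≡ + d
  bézout-ℤ {d} {m} {n} (Bézout.+- x y eq) = + x , - + y , (begin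
      + m * + x + + n * - + y   ≡⟨ commute (+ m) (+ x) (+ n) (+ y) ⟩
      + x * + m - + y * + n     ≡⟨ cong₂ _-_ (sym (pos-* x m)) (sym (pos-* y n)) ⟩
      + (x ℕ.* m) - + (y ℕ.* n) ≡⟨ cong (λ z → + z - + (y ℕ.* n)) eq ⟨
      + (d ℕ.+ y ℕ.* n) - + (y ℕ.* n) ≡⟨ cong (_- + (y ℕ.* n)) (pos-+ d (y ℕ.* n)) ⟩
      + d + + (y ℕ.* n) - + (y ℕ.* n) ≡⟨ cancel (+ d) (+ (y ℕ.* n)) ⟩
      + d ∎)
    where
    commute : ∀ m x n y → m * x + n * - y ≡ x * m - y * n
    commute = solve-∀
    cancel : ∀ d c → d + c - c ≡ d
    cancel = solve-∀
  bézout-ℤ {m = m} {n} (Bézout.-+ x y eq) with bézout-ℤ (Bézout.+- y x eq)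
  ... | β , α , e = α , β , trans (swap (+ m) α (+ n) β) e
    where
    swap : ∀ m α n β → m * α + n * β ≡ n * β + m * α
    swap = solve-∀

  range-weaken : ∀ {u x} → 0 < x × x ≤ u → 0 < x × x ≤ u ℕ.+ u
  range-weaken {u} (0<x , x≤u) = 0<x , ℕ.m≤n⇒m≤n+o u x≤u

  range-shift : ∀ {u x} → 0 < x × x ≤ u → 0 < x ℕ.+ u × x ℕ.+ u ≤ u ℕ.+ u
  range-shift {u} {x} (0<x , x≤u) = ℕ.<-≤-trans 0<x (ℕ.m≤m+n x u) , ℕ.+-monoˡ-≤ u x≤u

  pos-*+* : ∀ a x b y → + (a ℕ.* x ℕ.+ b ℕ.* y) ≡ + a * + x + + b * + y
  pos-*+* a x b y = trans (pos-+ (a ℕ.* x) (b ℕ.* y)) (cong₂ _+_ (pos-* a x) (pos-* b y))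

  pos-*≡pos-* : ∀ b c {u w} → b ℕ.* u ≡ c ℕ.* w → + b * + u ≡ + c * + w
  pos-*≡pos-* b c {u} {w} e = trans (sym (pos-* b u)) (trans (cong +_ e) (pos-* c w))

  s+p-q≡s : ∀ s {p q} → p ≡ q → s + p - q ≡ s
  s+p-q≡s s {p} refl = cancel s p
    where
    cancel : ∀ s p → s + p - p ≡ s
    cancel = solve-∀

  module ThreeTerm (b₁ b₂ b₃ m : ℕ) where

    record Solves (x₁ x₂ x₃ : ℤ) : Set where
      constructor solves
      field
        equation : + b₁ * x₁ + + b₂ * x₂ + + b₃ * x₃ ≡ + m

    solvable : gcd₃ b₁ b₂ b₃ ≡ 1 → Σ ℤ λ x₁ → Σ ℤ λ x₂ → Σ ℤ λ x₃ → Solves x₁ x₂ x₃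
    solvable gcd≡1
      with bézout-ℤ (Bézout.identity (gcd-GCD b₁ b₂)) | bézout-ℤ (coprime-Bézout (gcd≡1⇒coprime {gcd b₁ b₂} {b₃} gcd≡1))
    ... | α , β , e₁₂ | γ , δ , e = α * γ * + m , β * γ * + m , δ * + m , solves (begin
        + b₁ * (α * γ * + m) + + b₂ * (β * γ * + m) + + b₃ * (δ * + m)
          ≡⟨ regroup (+ b₁) (+ b₂) (+ b₃) α β γ δ (+ m) ⟩
        ((+ b₁ * α + + b₂ * β) * γ + + b₃ * δ) * + m
          ≡⟨ cong (λ g → (g * γ + + b₃ * δ) * + m) e₁₂ ⟩
        (+ gcd b₁ b₂ * γ + + b₃ * δ) * + m
          ≡⟨ cong (_* + m) e ⟩
        + 1 * + m
          ≡⟨ *-identityˡ (+ m) ⟩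
        + m ∎)
      where
      regroup : ∀ b₁ b₂ b₃ α β γ δ m →
        b₁ * (α * γ * m) + b₂ * (β * γ * m) + b₃ * (δ * m) ≡ ((b₁ * α + b₂ * β) * γ + b₃ * δ) * m
      regroup = solve-∀

    move₁₂ : ∀ {x₁ x₂ x₃} → Solves x₁ x₂ x₃ → Solves (x₁ + + b₂) (x₂ - + b₁) x₃
    move₁₂ {x₁} {x₂} {x₃} (solves e) = solves (trans (expand (+ b₁) (+ b₂) (+ b₃) x₁ x₂ x₃) e)
      where
      expand : ∀ b₁ b₂ b₃ x₁ x₂ x₃ →
        b₁ * (x₁ + b₂) + b₂ * (x₂ - b₁) + b₃ * x₃ ≡ b₁ * x₁ + b₂ * x₂ + b₃ * x₃
      expand = solve-∀

    move₁₃ : ∀ {u w x₁ x₂ x₃} → b₁ ℕ.* u ≡ b₃ ℕ.* w →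
             Solves x₁ x₂ x₃ → Solves (x₁ + + u) x₂ (x₃ - + w)
    move₁₃ {u} {w} {x₁} {x₂} {x₃} bal (solves e) = solves $
      trans (expand (+ b₁) (+ b₂) (+ b₃) x₁ x₂ x₃ (+ u) (+ w))
            (trans (s+p-q≡s _ (pos-*≡pos-* b₁ b₃ bal)) e)
      where
      expand : ∀ b₁ b₂ b₃ x₁ x₂ x₃ u w →
        b₁ * (x₁ + u) + b₂ * x₂ + b₃ * (x₃ - w) ≡ b₁ * x₁ + b₂ * x₂ + b₃ * x₃ + b₁ * u - b₃ * w
      expand = solve-∀

    move₂₃ : ∀ {u w x₁ x₂ x₃} → b₂ ℕ.* u ≡ b₃ ℕ.* w →
             Solves x₁ x₂ x₃ → Solves x₁ (x₂ + + u) (x₃ - + w)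
    move₂₃ {u} {w} {x₁} {x₂} {x₃} bal (solves e) = solves $
      trans (expand (+ b₁) (+ b₂) (+ b₃) x₁ x₂ x₃ (+ u) (+ w))
            (trans (s+p-q≡s _ (pos-*≡pos-* b₂ b₃ bal)) e)
      where
      expand : ∀ b₁ b₂ b₃ x₁ x₂ x₃ u w →
        b₁ * x₁ + b₂ * (x₂ + u) + b₃ * (x₃ - w) ≡ b₁ * x₁ + b₂ * x₂ + b₃ * x₃ + b₂ * u - b₃ * w
      expand = solve-∀

    transfer₁₃ : ∀ {u w x₁ x₂ x₃} k → b₁ ℕ.* u ≡ b₃ ℕ.* w →
             Solves (x₁ + k * + u) x₂ x₃ → Solves x₁ x₂ (x₃ + k * + w)
    transfer₁₃ {u} {w} {x₁} {x₂} {x₃} k bal (solves e) = solves $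
      trans (expand (+ b₁) (+ b₂) (+ b₃) x₁ x₂ x₃ (+ u) (+ w) k)
            (trans (s+p-q≡s _ (cong (k *_) (sym (pos-*≡pos-* b₁ b₃ bal)))) e)
      where
      expand : ∀ b₁ b₂ b₃ x₁ x₂ x₃ u w k →
        b₁ * x₁ + b₂ * x₂ + b₃ * (x₃ + k * w)
          ≡ b₁ * (x₁ + k * u) + b₂ * x₂ + b₃ * x₃ + k * (b₃ * w) - k * (b₁ * u)
      expand = solve-∀

    transfer₂₃ : ∀ {u w x₁ x₂ x₃} k → b₂ ℕ.* u ≡ b₃ ℕ.* w →
             Solves x₁ (x₂ + k * + u) x₃ → Solves x₁ x₂ (x₃ + k * + w)
    transfer₂₃ {u} {w} {x₁} {x₂} {x₃} k bal (solves e) = solves $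
      trans (expand (+ b₁) (+ b₂) (+ b₃) x₁ x₂ x₃ (+ u) (+ w) k)
            (trans (s+p-q≡s _ (cong (k *_) (sym (pos-*≡pos-* b₂ b₃ bal)))) e)
      where
      expand : ∀ b₁ b₂ b₃ x₁ x₂ x₃ u w k →
        b₁ * x₁ + b₂ * x₂ + b₃ * (x₃ + k * w)
          ≡ b₁ * x₁ + b₂ * (x₂ + k * u) + b₃ * x₃ + k * (b₃ * w) - k * (b₂ * u)
      expand = solve-∀

    solves-ℕ : ∀ {x₁ x₂ x₃} → Solves (+ x₁) (+ x₂) (+ x₃) → b₁ ℕ.* x₁ ℕ.+ b₂ ℕ.* x₂ ℕ.+ b₃ ℕ.* x₃ ≡ m
    solves-ℕ {x₁} {x₂} {x₃} (solves e) = +-injective (begin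
      + (b₁ ℕ.* x₁ ℕ.+ b₂ ℕ.* x₂ ℕ.+ b₃ ℕ.* x₃)  ≡⟨ pos-+ (b₁ ℕ.* x₁ ℕ.+ b₂ ℕ.* x₂) (b₃ ℕ.* x₃) ⟩
      + (b₁ ℕ.* x₁ ℕ.+ b₂ ℕ.* x₂) + + (b₃ ℕ.* x₃) ≡⟨ cong₂ _+_ (pos-*+* b₁ x₁ b₂ x₂) (pos-* b₃ x₃) ⟩
      + b₁ * + x₁ + + b₂ * + x₂ + + b₃ * + x₃     ≡⟨ e ⟩
      + m                                         ∎)

    nonpositive-third : ∀ {x₁ x₂} c → Solves (+ x₁) (+ x₂) (- + c) → m ≤ b₁ ℕ.* x₁ ℕ.+ b₂ ℕ.* x₂
    nonpositive-third {x₁} {x₂} c (solves e) = subst (m ℕ.≤_) (sym s≡m+b₃c) (ℕ.m≤m+n m (b₃ ℕ.* c))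
      where
      isolate : ∀ y₁ y₂ b c → y₁ + y₂ ≡ y₁ + y₂ + b * - c + b * c
      isolate = solve-∀
      s≡m+b₃c : b₁ ℕ.* x₁ ℕ.+ b₂ ℕ.* x₂ ≡ m ℕ.+ b₃ ℕ.* c
      s≡m+b₃c = +-injective (begin
        + (b₁ ℕ.* x₁ ℕ.+ b₂ ℕ.* x₂)           ≡⟨ pos-*+* b₁ x₁ b₂ x₂ ⟩
        + b₁ * + x₁ + + b₂ * + x₂             ≡⟨ isolate (+ b₁ * + x₁) (+ b₂ * + x₂) (+ b₃) (+ c) ⟩
        + b₁ * + x₁ + + b₂ * + x₂ + + b₃ * - + c + + b₃ * + c ≡⟨ cong (_+ + b₃ * + c) e ⟩
        + m + + b₃ * + c                      ≡⟨ cong (λ z → + m + z) (pos-* b₃ c) ⟨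
        + m + + (b₃ ℕ.* c)                    ≡⟨ pos-+ m (b₃ ℕ.* c) ⟨
        + (m ℕ.+ b₃ ℕ.* c)                    ∎)

    third-positive : ∀ {x₁ x₂ x₃} → b₁ ℕ.* x₁ ℕ.+ b₂ ℕ.* x₂ < m →
                     Solves (+ x₁) (+ x₂) x₃ → Σ ℕ λ t → x₃ ≡ + suc t
    third-positive {x₃ = + suc t}   _   _   = t , refl
    third-positive {x₃ = + zero}    s<m sol = ⊥-elim (ℕ.<⇒≱ s<m (nonpositive-third 0 sol))
    third-positive {x₃ = -[1+ k ]}  s<m sol = ⊥-elim (ℕ.<⇒≱ s<m (nonpositive-third (suc k) sol))

    module Separation
      {u₁₃ w₁₃ u₂₃ w₂₃ q₁₂ q₁₃ q₂₃ : ℕ} {{_ : NonZero u₁₃}} {{_ : NonZero u₂₃}}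
      (gcd≡1 : gcd₃ b₁ b₂ b₃ ≡ 1)
      (room : b₁ ℕ.* (u₁₃ ℕ.+ u₁₃) ℕ.+ b₂ ℕ.* (u₂₃ ℕ.+ u₂₃) < m)
      (balanced₁₃ : b₁ ℕ.* u₁₃ ≡ b₃ ℕ.* w₁₃) (balanced₂₃ : b₂ ℕ.* u₂₃ ≡ b₃ ℕ.* w₂₃)
      (q₁₂∤b₂,b₁ : ¬ (q₁₂ ∣ b₂ × q₁₂ ∣ b₁))
      (q₁₃∤u₁₃,w₁₃ : ¬ (q₁₃ ∣ u₁₃ × q₁₃ ∣ w₁₃))
      (q₂₃∤u₂₃,w₂₃ : ¬ (q₂₃ ∣ u₂₃ × q₂₃ ∣ w₂₃))
      (q₁₂∣u₁₃ : q₁₂ ∣ u₁₃) (q₁₂∣u₂₃ : q₁₂ ∣ u₂₃) (q₁₃∣w₂₃ : q₁₃ ∣ w₂₃)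
      where

      record Representation : Set where
        constructor representation
        field
          x₁ x₂ x₃ : ℕ
          positive : 0 < x₁ × 0 < x₂ × 0 < x₃
          equation : b₁ ℕ.* x₁ ℕ.+ b₂ ℕ.* x₂ ℕ.+ b₃ ℕ.* x₃ ≡ m
          separated₁₂ : ¬ (q₁₂ ∣ x₁ × q₁₂ ∣ x₂)
          separated₁₃ : ¬ (q₁₃ ∣ x₁ × q₁₃ ∣ x₃)
          separated₂₃ : ¬ (q₂₃ ∣ x₂ × q₂₃ ∣ x₃)

      private
        ℕ-separated : ∀ {q x y} → NotCommonDivisor q (+ x) (+ y) → ¬ (q ∣ x × q ∣ y)
        ℕ-separated sep (q∣x , q∣y) = sep (Signed.∣ᵤ⇒∣ q∣x , Signed.∣ᵤ⇒∣ q∣y)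

      conclude : ∀ {x₁ x₂ x₃} → 0 < x₁ × x₁ ≤ u₁₃ ℕ.+ u₁₃ → 0 < x₂ × x₂ ≤ u₂₃ ℕ.+ u₂₃ →
                 Solves (+ x₁) (+ x₂) x₃ → NotCommonDivisor q₁₂ (+ x₁) (+ x₂) →
                 NotCommonDivisor q₁₃ (+ x₁) x₃ → NotCommonDivisor q₂₃ (+ x₂) x₃ → Representation
      conclude {x₁} {x₂} (0<x₁ , x₁≤) (0<x₂ , x₂≤) sol s₁₂ s₁₃ s₂₃
        with third-positive (ℕ.≤-<-trans (ℕ.+-mono-≤ (ℕ.*-monoʳ-≤ b₁ x₁≤) (ℕ.*-monoʳ-≤ b₂ x₂≤)) room) sol
      ... | t , refl = representation x₁ x₂ (suc t) (0<x₁ , 0<x₂ , z<s) (solves-ℕ sol)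
                         (ℕ-separated s₁₂) (ℕ-separated s₁₃) (ℕ-separated s₂₃)

      separate₂₃ : ∀ {x₁ x₂ x₃} → 0 < x₁ × x₁ ≤ u₁₃ ℕ.+ u₁₃ → 0 < x₂ × x₂ ≤ u₂₃ →
                   Solves (+ x₁) (+ x₂) x₃ → NotCommonDivisor q₁₂ (+ x₁) (+ x₂) →
                   NotCommonDivisor q₁₃ (+ x₁) x₃ → Representation
      separate₂₃ {x₁} {x₂} {x₃} r₁ r₂ sol s₁₂ s₁₃ with separate q₂₃ q₂₃∤u₂₃,w₂₃ (+ x₂) x₃
      ... | inj₁ s₂₃ = conclude r₁ (range-weaken r₂) sol s₁₂ s₁₃ s₂₃
      ... | inj₂ s₂₃ = conclude r₁ (range-shift r₂) (move₂₃ balanced₂₃ sol)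
        (λ (q∣x₁ , q∣x₂+u) → s₁₂ (q∣x₁ , ∣ℤ-+⇒∣ℤ {x = + x₂} q₁₂∣u₂₃ q∣x₂+u))
        (λ (q∣x₁ , q∣x₃-w) → s₁₃ (q∣x₁ , ∣ℤ--⇒∣ℤ {x = x₃} q₁₃∣w₂₃ q∣x₃-w))
        s₂₃

      separate₁₃ : ∀ {x₁ x₂ x₃} → 0 < x₁ × x₁ ≤ u₁₃ → 0 < x₂ × x₂ ≤ u₂₃ →
                   Solves (+ x₁) (+ x₂) x₃ → NotCommonDivisor q₁₂ (+ x₁) (+ x₂) → Representation
      separate₁₃ {x₁} {x₂} {x₃} r₁ r₂ sol s₁₂ with separate q₁₃ q₁₃∤u₁₃,w₁₃ (+ x₁) x₃
      ... | inj₁ s₁₃ = separate₂₃ (range-weaken r₁) r₂ sol s₁₂ s₁₃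
      ... | inj₂ s₁₃ = separate₂₃ (range-shift r₁) r₂ (move₁₃ balanced₁₃ sol)
        (λ (q∣x₁+u , q∣x₂) → s₁₂ (∣ℤ-+⇒∣ℤ {x = + x₁} q₁₂∣u₁₃ q∣x₁+u , q∣x₂))
        s₁₃

      reduce : ∀ {x₁ x₂ x₃} → Solves x₁ x₂ x₃ → NotCommonDivisor q₁₂ x₁ x₂ → Representation
      reduce {x₁} {x₂} sol s₁₂ with positive-residue u₁₃ x₁ | positive-residue u₂₃ x₂
      ... | _ , z₁<u , k₁ , refl | _ , z₂<u , k₂ , refl =
        separate₁₃ (z<s , z₁<u) (z<s , z₂<u) (transfer₂₃ k₂ balanced₂₃ (transfer₁₃ k₁ balanced₁₃ sol))
          (λ (q∣y₁ , q∣y₂) → s₁₂ (∣ℤ⇒∣ℤ-+* k₁ q₁₂∣u₁₃ q∣y₁ , ∣ℤ⇒∣ℤ-+* k₂ q₁₂∣u₂₃ q∣y₂))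

      normalise : ∀ {x₁ x₂ x₃} → Solves x₁ x₂ x₃ → Representation
      normalise {x₁} {x₂} sol with separate q₁₂ q₁₂∤b₂,b₁ x₁ x₂
      ... | inj₁ s₁₂ = reduce sol s₁₂
      ... | inj₂ s₁₂ = reduce (move₁₂ sol) s₁₂

      separated-representation : Representation
      separated-representation = let (_ , _ , _ , sol) = solvable gcd≡1 in normalise sol

open import Data.Nat.Base using (_+_; _*_)
open import Data.Nat.Tactic.RingSolver using (solve-∀)

prime>1 : ∀ {p} → Prime p → 1 < p
prime>1 {p} pp = nonTrivial⇒n>1 p {{prime⇒nonTrivial pp}}

prime∤1 : ∀ {p} → Prime p → ¬ p ∣ 1
prime∤1 pp p∣1 = ℕ.<-irrefl (sym (∣1⇒≡1 p∣1)) (prime>1 pp)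

prime∣prime⇒≡ : ∀ {q p} → Prime q → Prime p → q ∣ p → q ≡ p
prime∣prime⇒≡ pq pp q∣p with prime⇒irreducible pp q∣p
... | inj₁ q≡1 = ⊥-elim (ℕ.<-irrefl (sym q≡1) (prime>1 pq))
... | inj₂ q≡p = q≡p

prime∣*prime⇒ : ∀ {q p} a → Prime q → Prime p → q ∣ a * p → q ∣ a ⊎ q ≡ p
prime∣*prime⇒ a pq pp q∣ap = map₂ (prime∣prime⇒≡ pq pp) (euclidsLemma a _ pq q∣ap)

∣*prime⇒∣ : ∀ {q p} a → Prime q → Prime p → q ≢ p → q ∣ a * p → q ∣ a
∣*prime⇒∣ a pq pp q≢p q∣ap = [ id , ⊥-elim ∘ q≢p ] (prime∣*prime⇒ a pq pp q∣ap)

prime∣a*p*r*s⇒ : ∀ {q p r s} a → Prime q → Prime p → Prime r → Prime s →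
                 q ∣ a * p * r * s → q ∣ a ⊎ q ≡ p ⊎ q ≡ r ⊎ q ≡ s
prime∣a*p*r*s⇒ a pq pp pr ps q∣aprs with prime∣*prime⇒ _ pq ps q∣aprs
... | inj₂ q≡s = inj₂ (inj₂ (inj₂ q≡s))
... | inj₁ q∣apr with prime∣*prime⇒ _ pq pr q∣apr
...   | inj₂ q≡r = inj₂ (inj₂ (inj₁ q≡r))
...   | inj₁ q∣ap = map₂ inj₁ (prime∣*prime⇒ a pq pp q∣ap)

∣a*p*r*s⇒∣a : ∀ {q p r s} a → Prime q → Prime p → Prime r → Prime s →
              q ≢ p → q ≢ r → q ≢ s → q ∣ a * p * r * s → q ∣ a
∣a*p*r*s⇒∣a a pq pp pr ps q≢p q≢r q≢s =
  ∣*prime⇒∣ a pq pp q≢p ∘ ∣*prime⇒∣ _ pq pr q≢r ∘ ∣*prime⇒∣ _ pq ps q≢s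

m*n*o*p≢0 : ∀ m n o p .{{_ : NonZero m}} .{{_ : NonZero n}} .{{_ : NonZero o}} .{{_ : NonZero p}} →
            NonZero (m * n * o * p)
m*n*o*p≢0 m n o p = ℕ.m*n≢0 (m * n * o) p {{ℕ.m*n≢0 (m * n) o {{ℕ.m*n≢0 m n}}}}

gcd-nonZeroʳ : ∀ m n .{{_ : NonZero n}} → NonZero (gcd m n)
gcd-nonZeroʳ m n = ≢-nonZero (gcd[m,n]≢0 m n (inj₂ (≢-nonZero⁻¹ n)))

no-prime-divisor⇒≡1 : ∀ n .{{_ : NonZero n}} → (∀ {q} → Prime q → ¬ q ∣ n) → n ≡ 1
no-prime-divisor⇒≡1 n no-prime with factorise n
... | record { factors = [] ; isFactorisation = n≡1 } = n≡1
... | record { factors = q ∷ _ ; isFactorisation = n≡q*qs ; factorsPrime = pq ∷ _ } =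
  ⊥-elim (no-prime pq (subst (q ∣_) (sym n≡q*qs) (m∣m*n _)))

∣gcd₃⇒ : ∀ {q} a b c → q ∣ gcd₃ a b c → q ∣ a × q ∣ b × q ∣ c
∣gcd₃⇒ a b c q∣g = ∣-trans q∣gab (gcd[m,n]∣m a b) , ∣-trans q∣gab (gcd[m,n]∣n a b)
                 , ∣-trans q∣g (gcd[m,n]∣n (gcd a b) c)
  where q∣gab = ∣-trans q∣g (gcd[m,n]∣m (gcd a b) c)

gcd₃≡1 : ∀ a b c .{{_ : NonZero c}} → (∀ {q} → Prime q → q ∣ a → q ∣ b → q ∣ c → ⊥) → gcd₃ a b c ≡ 1
gcd₃≡1 a b c no-common = no-prime-divisor⇒≡1 (gcd₃ a b c) {{gcd-nonZeroʳ (gcd a b) c}} λ pq q∣g →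
  let (q∣a , q∣b , q∣c) = ∣gcd₃⇒ a b c q∣g in no-common pq q∣a q∣b q∣c

gcd₄≡1 : ∀ a b c d .{{_ : NonZero d}} →
         (∀ {q} → Prime q → q ∣ a → q ∣ b → q ∣ c → q ∣ d → ⊥) → gcd₄ a b c d ≡ 1
gcd₄≡1 a b c d no-common = no-prime-divisor⇒≡1 (gcd₄ a b c d) {{gcd-nonZeroʳ (gcd₃ a b c) d}} λ pq q∣g →
  let (q∣a , q∣b , q∣c) = ∣gcd₃⇒ a b c (∣-trans q∣g (gcd[m,n]∣m (gcd₃ a b c) d))
  in no-common pq q∣a q∣b q∣c (∣-trans q∣g (gcd[m,n]∣n (gcd₃ a b c) d))

prime∣both⇒1<gcd : ∀ {p x y} → Prime p → .{{_ : NonZero y}} → p ∣ x → p ∣ y → 1 < gcd x y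
prime∣both⇒1<gcd {x = x} {y} pp p∣x p∣y =
  ℕ.<-≤-trans (prime>1 pp) (∣⇒≤ {{gcd-nonZeroʳ x y}} (gcd-greatest p∣x p∣y))

prime∤both-/gcd : ∀ {q} m n .{{_ : NonZero (gcd m n)}} → Prime q → ¬ (q ∣ m / gcd m n × q ∣ n / gcd m n)
prime∤both-/gcd m n pq q∣both = ℕ.<-irrefl (sym (coprime-/gcd m n q∣both)) (prime>1 pq)

m*[n/gcd[m,n]]≡n*[m/gcd[m,n]] : ∀ m n .{{_ : NonZero (gcd m n)}} → m * (n / gcd m n) ≡ n * (m / gcd m n)
m*[n/gcd[m,n]]≡n*[m/gcd[m,n]] m n = begin
  m * (n / gcd m n) ≡⟨ *-/-assoc m (gcd[m,n]∣n m n) ⟨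
  m * n / gcd m n   ≡⟨ cong (_/ gcd m n) (ℕ.*-comm m n) ⟩
  n * m / gcd m n   ≡⟨ *-/-assoc n (gcd[m,n]∣m m n) ⟩
  n * (m / gcd m n) ∎
  where open ≡-Reasoning

lcm≡m*[n/gcd[m,n]] : ∀ m n .{{_ : NonZero m}} .{{_ : NonZero (gcd m n)}} → lcm m n ≡ m * (n / gcd m n)
lcm≡m*[n/gcd[m,n]] (suc _) _ = refl


module Construction
  (a₁ a₂ a₃ a₄ : ℕ) (0<a₁ : 0 < a₁) (0<a₂ : 0 < a₂) (0<a₃ : 0 < a₃)
  (gcd[a₁,a₂,a₃]≡1 : gcd₃ a₁ a₂ a₃ ≡ 1)
  {p₁₂ p₁₃ p₁₄ p₂₃ p₂₄ p₃₄ : ℕ}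
  (pr₁₂ : Prime p₁₂) (pr₁₃ : Prime p₁₃) (pr₁₄ : Prime p₁₄)
  (pr₂₃ : Prime p₂₃) (pr₂₄ : Prime p₂₄) (pr₃₄ : Prime p₃₄)
  (p₁₂≢p₁₃ : p₁₂ ≢ p₁₃) (p₁₂≢p₁₄ : p₁₂ ≢ p₁₄) (p₁₂≢p₂₃ : p₁₂ ≢ p₂₃) (p₁₂≢p₂₄ : p₁₂ ≢ p₂₄)
  (p₁₂≢p₃₄ : p₁₂ ≢ p₃₄) (p₁₃≢p₁₄ : p₁₃ ≢ p₁₄) (p₁₃≢p₂₃ : p₁₃ ≢ p₂₃) (p₁₃≢p₂₄ : p₁₃ ≢ p₂₄)
  (p₁₃≢p₃₄ : p₁₃ ≢ p₃₄) (p₁₄≢p₂₃ : p₁₄ ≢ p₂₃) (p₁₄≢p₂₄ : p₁₄ ≢ p₂₄) (p₁₄≢p₃₄ : p₁₄ ≢ p₃₄)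
  (p₂₃≢p₂₄ : p₂₃ ≢ p₂₄) (p₂₃≢p₃₄ : p₂₃ ≢ p₃₄) (p₂₄≢p₃₄ : p₂₄ ≢ p₃₄)
  (p₁₄∤a₁ : ¬ p₁₄ ∣ a₁) (p₂₄∤a₂ : ¬ p₂₄ ∣ a₂) (p₃₄∤a₃ : ¬ p₃₄ ∣ a₃)
  (p₁₂∤gcd[a₁,a₂] : ¬ p₁₂ ∣ gcd a₁ a₂) (p₁₃∤gcd[a₁,a₃] : ¬ p₁₃ ∣ gcd a₁ a₃)
  (p₂₃∤gcd[a₂,a₃] : ¬ p₂₃ ∣ gcd a₂ a₃)
  (n : ℕ) (bound≤n : bound a₁ a₂ a₃ a₄ p₁₂ p₁₃ p₁₄ p₂₃ p₂₄ p₃₄ ≤ n)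
  where

  instance
    _ = >-nonZero 0<a₁
    _ = >-nonZero 0<a₂
    _ = >-nonZero 0<a₃
    _ = prime⇒nonZero pr₁₂
    _ = prime⇒nonZero pr₁₃
    _ = prime⇒nonZero pr₁₄
    _ = prime⇒nonZero pr₂₃
    _ = prime⇒nonZero pr₂₄
    _ = prime⇒nonZero pr₃₄
    _ = gcd-nonZeroʳ a₁ a₃
    _ = gcd-nonZeroʳ a₂ a₃

  π₁ π₂ π₃ π₄ : ℕ → ℕ
  π₁ c = c * p₂₃ * p₂₄ * p₃₄
  π₂ c = c * p₁₃ * p₁₄ * p₃₄
  π₃ c = c * p₁₂ * p₁₄ * p₂₄
  π₄ c = c * p₁₂ * p₁₃ * p₂₃

  ∣π₁⇒∣ : ∀ {q} c → Prime q → q ≢ p₂₃ → q ≢ p₂₄ → q ≢ p₃₄ → q ∣ π₁ c → q ∣ c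
  ∣π₁⇒∣ c pq = ∣a*p*r*s⇒∣a c pq pr₂₃ pr₂₄ pr₃₄

  ∣π₂⇒∣ : ∀ {q} c → Prime q → q ≢ p₁₃ → q ≢ p₁₄ → q ≢ p₃₄ → q ∣ π₂ c → q ∣ c
  ∣π₂⇒∣ c pq = ∣a*p*r*s⇒∣a c pq pr₁₃ pr₁₄ pr₃₄

  ∣π₃⇒∣ : ∀ {q} c → Prime q → q ≢ p₁₂ → q ≢ p₁₄ → q ≢ p₂₄ → q ∣ π₃ c → q ∣ c
  ∣π₃⇒∣ c pq = ∣a*p*r*s⇒∣a c pq pr₁₂ pr₁₄ pr₂₄

  b₁ b₂ b₃ : ℕ
  b₁ = π₁ a₁
  b₂ = π₂ a₂
  b₃ = π₃ a₃

  instance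
    _ = m*n*o*p≢0 a₃ p₁₂ p₁₄ p₂₄

  p₁₂∤b₂,b₁ : ¬ (p₁₂ ∣ b₂ × p₁₂ ∣ b₁)
  p₁₂∤b₂,b₁ (p₁₂∣b₂ , p₁₂∣b₁) = p₁₂∤gcd[a₁,a₂] (gcd-greatest
    (∣π₁⇒∣ a₁ pr₁₂ p₁₂≢p₂₃ p₁₂≢p₂₄ p₁₂≢p₃₄ p₁₂∣b₁) (∣π₂⇒∣ a₂ pr₁₂ p₁₂≢p₁₃ p₁₂≢p₁₄ p₁₂≢p₃₄ p₁₂∣b₂))

  no-prime-divides-b : ∀ {q} → Prime q → q ∣ b₁ → q ∣ b₂ → q ∣ b₃ → ⊥
  no-prime-divides-b {q} pq q∣b₁ q∣b₂ q∣b₃ with prime∣a*p*r*s⇒ a₃ pq pr₁₂ pr₁₄ pr₂₄ q∣b₃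
  ... | inj₂ (inj₁ refl) = p₁₂∤b₂,b₁ (q∣b₂ , q∣b₁)
  ... | inj₂ (inj₂ (inj₁ refl)) = p₁₄∤a₁ (∣π₁⇒∣ a₁ pq p₁₄≢p₂₃ p₁₄≢p₂₄ p₁₄≢p₃₄ q∣b₁)
  ... | inj₂ (inj₂ (inj₂ refl)) = p₂₄∤a₂ (∣π₂⇒∣ a₂ pq (≢-sym p₁₃≢p₂₄) (≢-sym p₁₄≢p₂₄) p₂₄≢p₃₄ q∣b₂)
  ... | inj₁ q∣a₃ with prime∣a*p*r*s⇒ a₁ pq pr₂₃ pr₂₄ pr₃₄ q∣b₁
  ...   | inj₂ (inj₁ refl) = p₂₃∤gcd[a₂,a₃] (gcd-greatest
            (∣π₂⇒∣ a₂ pq (≢-sym p₁₃≢p₂₃) (≢-sym p₁₄≢p₂₃) p₂₃≢p₃₄ q∣b₂) q∣a₃)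
  ...   | inj₂ (inj₂ (inj₁ refl)) = p₂₄∤a₂ (∣π₂⇒∣ a₂ pq (≢-sym p₁₃≢p₂₄) (≢-sym p₁₄≢p₂₄) p₂₄≢p₃₄ q∣b₂)
  ...   | inj₂ (inj₂ (inj₂ refl)) = p₃₄∤a₃ q∣a₃
  ...   | inj₁ q∣a₁ with prime∣a*p*r*s⇒ a₂ pq pr₁₃ pr₁₄ pr₃₄ q∣b₂
  ...     | inj₁ q∣a₂ = prime∤1 pq (subst (q ∣_) gcd[a₁,a₂,a₃]≡1 (gcd-greatest (gcd-greatest q∣a₁ q∣a₂) q∣a₃))
  ...     | inj₂ (inj₁ refl) = p₁₃∤gcd[a₁,a₃] (gcd-greatest q∣a₁ q∣a₃)
  ...     | inj₂ (inj₂ (inj₁ refl)) = p₁₄∤a₁ q∣a₁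
  ...     | inj₂ (inj₂ (inj₂ refl)) = p₃₄∤a₃ q∣a₃

  g₁₃ g₂₃ : ℕ
  g₁₃ = gcd a₁ a₃
  g₂₃ = gcd a₂ a₃

  -- b₁u₁₃ = b₃w₁₃ = lcm(a₁,a₃) p₁₂p₁₄p₂₃p₂₄p₃₄ and b₂u₂₃ = b₃w₂₃ = lcm(a₂,a₃) p₁₂p₁₃p₁₄p₂₄p₃₄,
  -- so the last two terms of the bound are 2b₁u₁₃ and 2b₂u₂₃.
  u₁₃ w₁₃ u₂₃ w₂₃ : ℕ
  u₁₃ = a₃ / g₁₃ * p₁₂ * p₁₄
  w₁₃ = a₁ / g₁₃ * p₂₃ * p₃₄
  u₂₃ = a₃ / g₂₃ * p₁₂ * p₂₄
  w₂₃ = a₂ / g₂₃ * p₁₃ * p₃₄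

  instance
    _ : NonZero u₁₃
    _ = ℕ.m*n≢0 _ _ {{ℕ.m*n≢0 _ _ {{≢-nonZero (n/gcd[m,n]≢0 a₁ a₃)}}}}
    _ : NonZero u₂₃
    _ = ℕ.m*n≢0 _ _ {{ℕ.m*n≢0 _ _ {{≢-nonZero (n/gcd[m,n]≢0 a₂ a₃)}}}}

  balanced₁₃ : b₁ * u₁₃ ≡ b₃ * w₁₃
  balanced₁₃ = begin
    a₁ * p₂₃ * p₂₄ * p₃₄ * (a₃ / g₁₃ * p₁₂ * p₁₄)  ≡⟨ regroup a₁ (a₃ / g₁₃) p₁₂ p₁₄ p₂₃ p₂₄ p₃₄ ⟩
    a₁ * (a₃ / g₁₃) * (p₁₂ * p₁₄ * p₂₃ * p₂₄ * p₃₄) ≡⟨ cong (_* (p₁₂ * p₁₄ * p₂₃ * p₂₄ * p₃₄)) (m*[n/gcd[m,n]]≡n*[m/gcd[m,n]] a₁ a₃) ⟩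
    a₃ * (a₁ / g₁₃) * (p₁₂ * p₁₄ * p₂₃ * p₂₄ * p₃₄) ≡⟨ regroup′ a₃ (a₁ / g₁₃) p₁₂ p₁₄ p₂₃ p₂₄ p₃₄ ⟩
    a₃ * p₁₂ * p₁₄ * p₂₄ * (a₁ / g₁₃ * p₂₃ * p₃₄)  ∎
    where
    open ≡-Reasoning
    regroup : ∀ a c p₁₂ p₁₄ p₂₃ p₂₄ p₃₄ →
      a * p₂₃ * p₂₄ * p₃₄ * (c * p₁₂ * p₁₄) ≡ a * c * (p₁₂ * p₁₄ * p₂₃ * p₂₄ * p₃₄)
    regroup = solve-∀
    regroup′ : ∀ a c p₁₂ p₁₄ p₂₃ p₂₄ p₃₄ →
      a * c * (p₁₂ * p₁₄ * p₂₃ * p₂₄ * p₃₄) ≡ a * p₁₂ * p₁₄ * p₂₄ * (c * p₂₃ * p₃₄)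
    regroup′ = solve-∀

  balanced₂₃ : b₂ * u₂₃ ≡ b₃ * w₂₃
  balanced₂₃ = begin
    a₂ * p₁₃ * p₁₄ * p₃₄ * (a₃ / g₂₃ * p₁₂ * p₂₄)  ≡⟨ regroup a₂ (a₃ / g₂₃) p₁₂ p₁₃ p₁₄ p₂₄ p₃₄ ⟩
    a₂ * (a₃ / g₂₃) * (p₁₂ * p₁₃ * p₁₄ * p₂₄ * p₃₄) ≡⟨ cong (_* (p₁₂ * p₁₃ * p₁₄ * p₂₄ * p₃₄)) (m*[n/gcd[m,n]]≡n*[m/gcd[m,n]] a₂ a₃) ⟩
    a₃ * (a₂ / g₂₃) * (p₁₂ * p₁₃ * p₁₄ * p₂₄ * p₃₄) ≡⟨ regroup′ a₃ (a₂ / g₂₃) p₁₂ p₁₃ p₁₄ p₂₄ p₃₄ ⟩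
    a₃ * p₁₂ * p₁₄ * p₂₄ * (a₂ / g₂₃ * p₁₃ * p₃₄)  ∎
    where
    open ≡-Reasoning
    regroup : ∀ a c p₁₂ p₁₃ p₁₄ p₂₄ p₃₄ →
      a * p₁₃ * p₁₄ * p₃₄ * (c * p₁₂ * p₂₄) ≡ a * c * (p₁₂ * p₁₃ * p₁₄ * p₂₄ * p₃₄)
    regroup = solve-∀
    regroup′ : ∀ a c p₁₂ p₁₃ p₁₄ p₂₄ p₃₄ →
      a * c * (p₁₂ * p₁₃ * p₁₄ * p₂₄ * p₃₄) ≡ a * p₁₂ * p₁₄ * p₂₄ * (c * p₁₃ * p₃₄)
    regroup′ = solve-∀

  p₁₂∣u₁₃ : p₁₂ ∣ u₁₃
  p₁₂∣u₁₃ = ∣m⇒∣m*n p₁₄ (n∣m*n (a₃ / g₁₃))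

  p₁₂∣u₂₃ : p₁₂ ∣ u₂₃
  p₁₂∣u₂₃ = ∣m⇒∣m*n p₂₄ (n∣m*n (a₃ / g₂₃))

  p₁₃∣w₂₃ : p₁₃ ∣ w₂₃
  p₁₃∣w₂₃ = ∣m⇒∣m*n p₃₄ (n∣m*n (a₂ / g₂₃))

  p₁₃∤u₁₃,w₁₃ : ¬ (p₁₃ ∣ u₁₃ × p₁₃ ∣ w₁₃)
  p₁₃∤u₁₃,w₁₃ (p₁₃∣u₁₃ , p₁₃∣w₁₃) = prime∤both-/gcd a₁ a₃ pr₁₃
    ( ∣*prime⇒∣ (a₁ / g₁₃) pr₁₃ pr₂₃ p₁₃≢p₂₃ (∣*prime⇒∣ (a₁ / g₁₃ * p₂₃) pr₁₃ pr₃₄ p₁₃≢p₃₄ p₁₃∣w₁₃)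
    , ∣*prime⇒∣ (a₃ / g₁₃) pr₁₃ pr₁₂ (≢-sym p₁₂≢p₁₃) (∣*prime⇒∣ (a₃ / g₁₃ * p₁₂) pr₁₃ pr₁₄ p₁₃≢p₁₄ p₁₃∣u₁₃) )

  p₂₃∤u₂₃,w₂₃ : ¬ (p₂₃ ∣ u₂₃ × p₂₃ ∣ w₂₃)
  p₂₃∤u₂₃,w₂₃ (p₂₃∣u₂₃ , p₂₃∣w₂₃) = prime∤both-/gcd a₂ a₃ pr₂₃
    ( ∣*prime⇒∣ (a₂ / g₂₃) pr₂₃ pr₁₃ (≢-sym p₁₃≢p₂₃) (∣*prime⇒∣ (a₂ / g₂₃ * p₁₃) pr₂₃ pr₃₄ p₂₃≢p₃₄ p₂₃∣w₂₃)
    , ∣*prime⇒∣ (a₃ / g₂₃) pr₂₃ pr₁₂ (≢-sym p₁₂≢p₂₃) (∣*prime⇒∣ (a₃ / g₂₃ * p₁₂) pr₂₃ pr₂₄ p₂₃≢p₂₄ p₂₃∣u₂₃) )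

  μ₄ : ℕ
  μ₄ = π₄ 1

  reserve : ℕ
  reserve = b₁ * (u₁₃ + u₁₃) + b₂ * (u₂₃ + u₂₃)

  bound≡ : bound a₁ a₂ a₃ a₄ p₁₂ p₁₃ p₁₄ p₂₃ p₂₄ p₃₄
           ≡ reserve + a₄ * μ₄ + (b₃ + lcm a₁ a₂ * p₁₃ * p₁₄ * p₂₃ * p₂₄ * p₃₄)
  bound≡ = trans (cong₂ (bound′ (lcm a₁ a₂)) (lcm≡m*[n/gcd[m,n]] a₁ a₃) (lcm≡m*[n/gcd[m,n]] a₂ a₃))
                 (rearrange a₁ a₂ a₃ a₄ (a₃ / g₁₃) (a₃ / g₂₃) (lcm a₁ a₂) p₁₂ p₁₃ p₁₄ p₂₃ p₂₄ p₃₄)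
    where
    bound′ : ℕ → ℕ → ℕ → ℕ
    bound′ L₁₂ L₁₃ L₂₃ = a₃ * p₁₂ * p₁₄ * p₂₄ + a₄ * p₁₂ * p₁₃ * p₂₃
      + L₁₂ * p₁₃ * p₁₄ * p₂₃ * p₂₄ * p₃₄ + 2 * L₁₃ * p₁₂ * p₁₄ * p₂₃ * p₂₄ * p₃₄
      + 2 * L₂₃ * p₁₂ * p₁₃ * p₁₄ * p₂₄ * p₃₄
    rearrange : ∀ a₁ a₂ a₃ a₄ c₁₃ c₂₃ L p₁₂ p₁₃ p₁₄ p₂₃ p₂₄ p₃₄ →
      a₃ * p₁₂ * p₁₄ * p₂₄ + a₄ * p₁₂ * p₁₃ * p₂₃ + L * p₁₃ * p₁₄ * p₂₃ * p₂₄ * p₃₄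
        + 2 * (a₁ * c₁₃) * p₁₂ * p₁₄ * p₂₃ * p₂₄ * p₃₄ + 2 * (a₂ * c₂₃) * p₁₂ * p₁₃ * p₁₄ * p₂₄ * p₃₄
      ≡ a₁ * p₂₃ * p₂₄ * p₃₄ * (c₁₃ * p₁₂ * p₁₄ + c₁₃ * p₁₂ * p₁₄)
        + a₂ * p₁₃ * p₁₄ * p₃₄ * (c₂₃ * p₁₂ * p₂₄ + c₂₃ * p₁₂ * p₂₄)
        + a₄ * (1 * p₁₂ * p₁₃ * p₂₃) + (a₃ * p₁₂ * p₁₄ * p₂₄ + L * p₁₃ * p₁₄ * p₂₃ * p₂₄ * p₃₄)
    rearrange = solve-∀

  reserve+a₄μ₄<n : reserve + a₄ * μ₄ < n
  reserve+a₄μ₄<n = ℕ.<-≤-trans (ℕ.m<m+n _ (ℕ.<-≤-trans (>-nonZero⁻¹ b₃) (ℕ.m≤m+n b₃ (lcm a₁ a₂ * p₁₃ * p₁₄ * p₂₃ * p₂₄ * p₃₄))))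
                         (subst (_≤ n) bound≡ bound≤n)

  m : ℕ
  m = n ∸ a₄ * μ₄

  room : reserve < m
  room = ℕ.m+n≤o⇒m≤o∸n _ reserve+a₄μ₄<n

  gcd[b₁,b₂,b₃]≡1 : gcd₃ b₁ b₂ b₃ ≡ 1
  gcd[b₁,b₂,b₃]≡1 = gcd₃≡1 b₁ b₂ b₃ no-prime-divides-b

  open LinearDiophantine.ThreeTerm b₁ b₂ b₃ m using (module Separation)
  open Separation gcd[b₁,b₂,b₃]≡1 room balanced₁₃ balanced₂₃ p₁₂∤b₂,b₁ p₁₃∤u₁₃,w₁₃ p₂₃∤u₂₃,w₂₃
                  p₁₂∣u₁₃ p₁₂∣u₂₃ p₁₃∣w₂₃
  open Representation separated-representation

  μ₁ μ₂ μ₃ : ℕ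
  μ₁ = π₁ x₁
  μ₂ = π₂ x₂
  μ₃ = π₃ x₃

  instance
    _ = m*n*o*p≢0 x₁ p₂₃ p₂₄ p₃₄ {{>-nonZero (proj₁ positive)}}
    _ = m*n*o*p≢0 x₂ p₁₃ p₁₄ p₃₄ {{>-nonZero (proj₁ (proj₂ positive))}}
    _ = m*n*o*p≢0 x₃ p₁₂ p₁₄ p₂₄ {{>-nonZero (proj₂ (proj₂ positive))}}
    _ = m*n*o*p≢0 1 p₁₂ p₁₃ p₂₃

  μ-positive : 0 < μ₁ × 0 < μ₂ × 0 < μ₃ × 0 < μ₄
  μ-positive = >-nonZero⁻¹ μ₁ , >-nonZero⁻¹ μ₂ , >-nonZero⁻¹ μ₃ , >-nonZero⁻¹ μ₄

  n≡Σaμ : n ≡ a₁ * μ₁ + a₂ * μ₂ + a₃ * μ₃ + a₄ * μ₄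
  n≡Σaμ = begin
    n                                        ≡⟨ ℕ.m+[n∸m]≡n a₄μ₄≤n ⟨
    a₄ * μ₄ + m                              ≡⟨ cong (a₄ * μ₄ +_) equation ⟨
    a₄ * μ₄ + (b₁ * x₁ + b₂ * x₂ + b₃ * x₃)  ≡⟨ regroup a₁ a₂ a₃ a₄ x₁ x₂ x₃ p₁₂ p₁₃ p₁₄ p₂₃ p₂₄ p₃₄ ⟩
    a₁ * μ₁ + a₂ * μ₂ + a₃ * μ₃ + a₄ * μ₄    ∎
    where
    open ≡-Reasoning
    a₄μ₄≤n : a₄ * μ₄ ≤ n
    a₄μ₄≤n = ℕ.≤-trans (ℕ.m≤n+m (a₄ * μ₄) reserve) (ℕ.<⇒≤ reserve+a₄μ₄<n)
    regroup : ∀ a₁ a₂ a₃ a₄ x₁ x₂ x₃ p₁₂ p₁₃ p₁₄ p₂₃ p₂₄ p₃₄ →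
      a₄ * (1 * p₁₂ * p₁₃ * p₂₃)
        + (a₁ * p₂₃ * p₂₄ * p₃₄ * x₁ + a₂ * p₁₃ * p₁₄ * p₃₄ * x₂ + a₃ * p₁₂ * p₁₄ * p₂₄ * x₃)
      ≡ a₁ * (x₁ * p₂₃ * p₂₄ * p₃₄) + a₂ * (x₂ * p₁₃ * p₁₄ * p₃₄) + a₃ * (x₃ * p₁₂ * p₁₄ * p₂₄)
        + a₄ * (1 * p₁₂ * p₁₃ * p₂₃)
    regroup = solve-∀

  no-common-prime : ∀ {q} → Prime q → q ∣ μ₁ → q ∣ μ₂ → q ∣ μ₃ →
                    q ∣ 1 ⊎ q ≡ p₁₂ ⊎ q ≡ p₁₃ ⊎ q ≡ p₂₃ → ⊥
  no-common-prime pq _ _ _ (inj₁ q∣1) = prime∤1 pq q∣1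
  no-common-prime pq q∣μ₁ q∣μ₂ _ (inj₂ (inj₁ refl)) = separated₁₂
    ( ∣π₁⇒∣ x₁ pq p₁₂≢p₂₃ p₁₂≢p₂₄ p₁₂≢p₃₄ q∣μ₁
    , ∣π₂⇒∣ x₂ pq p₁₂≢p₁₃ p₁₂≢p₁₄ p₁₂≢p₃₄ q∣μ₂ )
  no-common-prime pq q∣μ₁ _ q∣μ₃ (inj₂ (inj₂ (inj₁ refl))) = separated₁₃
    ( ∣π₁⇒∣ x₁ pq p₁₃≢p₂₃ p₁₃≢p₂₄ p₁₃≢p₃₄ q∣μ₁
    , ∣π₃⇒∣ x₃ pq (≢-sym p₁₂≢p₁₃) p₁₃≢p₁₄ p₁₃≢p₂₄ q∣μ₃ )
  no-common-prime pq _ q∣μ₂ q∣μ₃ (inj₂ (inj₂ (inj₂ refl))) = separated₂₃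
    ( ∣π₂⇒∣ x₂ pq (≢-sym p₁₃≢p₂₃) (≢-sym p₁₄≢p₂₃) p₂₃≢p₃₄ q∣μ₂
    , ∣π₃⇒∣ x₃ pq (≢-sym p₁₂≢p₂₃) (≢-sym p₁₄≢p₂₃) p₂₃≢p₂₄ q∣μ₃ )

  gcd[μ]≡1 : gcd₄ μ₁ μ₂ μ₃ μ₄ ≡ 1
  gcd[μ]≡1 = gcd₄≡1 μ₁ μ₂ μ₃ μ₄ λ pq q∣μ₁ q∣μ₂ q∣μ₃ q∣μ₄ →
    no-common-prime pq q∣μ₁ q∣μ₂ q∣μ₃ (prime∣a*p*r*s⇒ 1 pq pr₁₂ pr₁₃ pr₂₃ q∣μ₄)

  pairwise-gcd>1 : 1 < gcd μ₁ μ₂ × 1 < gcd μ₁ μ₃ × 1 < gcd μ₁ μ₄ ×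
                   1 < gcd μ₂ μ₃ × 1 < gcd μ₂ μ₄ × 1 < gcd μ₃ μ₄
  pairwise-gcd>1 =
      prime∣both⇒1<gcd pr₃₄ (n∣m*n (x₁ * p₂₃ * p₂₄)) (n∣m*n (x₂ * p₁₃ * p₁₄))
    , prime∣both⇒1<gcd pr₂₄ (n∣m*n*o (x₁ * p₂₃) p₃₄) (n∣m*n (x₃ * p₁₂ * p₁₄))
    , prime∣both⇒1<gcd pr₂₃ (∣m⇒∣m*n p₃₄ (n∣m*n*o x₁ p₂₄)) (n∣m*n (1 * p₁₂ * p₁₃))
    , prime∣both⇒1<gcd pr₁₄ (n∣m*n*o (x₂ * p₁₃) p₃₄) (n∣m*n*o (x₃ * p₁₂) p₂₄)
    , prime∣both⇒1<gcd pr₁₃ (∣m⇒∣m*n p₃₄ (n∣m*n*o x₂ p₁₄)) (n∣m*n*o (1 * p₁₂) p₂₃)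
    , prime∣both⇒1<gcd pr₁₂ (∣m⇒∣m*n p₂₄ (n∣m*n*o x₃ p₁₄)) (∣m⇒∣m*n p₂₃ (n∣m*n*o 1 p₁₃))

mainTheorem5 : (a₁ a₂ a₃ a₄ : ℕ) → 0 < a₁ → 0 < a₂ → 0 < a₃ → 0 < a₄ →
    gcd₃ a₁ a₂ a₃ ≡ 1 →
    (p₁₂ p₁₃ p₁₄ p₂₃ p₂₄ p₃₄ : ℕ) →
    Prime p₁₂ → Prime p₁₃ → Prime p₁₄ → Prime p₂₃ → Prime p₂₄ → Prime p₃₄ →
    Unique (p₁₂ ∷ p₁₃ ∷ p₁₄ ∷ p₂₃ ∷ p₂₄ ∷ p₃₄ ∷ []) →
    ¬ (p₁₄ ∣ a₁) → ¬ (p₂₄ ∣ a₂) → ¬ (p₃₄ ∣ a₃) →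
    ¬ (p₁₂ ∣ gcd a₁ a₂) → ¬ (p₁₃ ∣ gcd a₁ a₃) → ¬ (p₂₃ ∣ gcd a₂ a₃) →
    (n : ℕ) → 0 < n →
    bound a₁ a₂ a₃ a₄ p₁₂ p₁₃ p₁₄ p₂₃ p₂₄ p₃₄ ≤ n →
    Σ ℕ λ μ₁ → Σ ℕ λ μ₂ → Σ ℕ λ μ₃ → Σ ℕ λ μ₄ →
      (0 < μ₁ × 0 < μ₂ × 0 < μ₃ × 0 < μ₄) ×
      n ≡ a₁ * μ₁ + a₂ * μ₂ + a₃ * μ₃ + a₄ * μ₄ ×
      gcd₄ μ₁ μ₂ μ₃ μ₄ ≡ 1 ×
      (1 < gcd μ₁ μ₂ × 1 < gcd μ₁ μ₃ × 1 < gcd μ₁ μ₄ ×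
       1 < gcd μ₂ μ₃ × 1 < gcd μ₂ μ₄ × 1 < gcd μ₃ μ₄)
mainTheorem5 a₁ a₂ a₃ a₄ 0<a₁ 0<a₂ 0<a₃ _ gcd[a₁,a₂,a₃]≡1 _ _ _ _ _ _
  pr₁₂ pr₁₃ pr₁₄ pr₂₃ pr₂₄ pr₃₄
  ( (p₁₂≢p₁₃ ∷ p₁₂≢p₁₄ ∷ p₁₂≢p₂₃ ∷ p₁₂≢p₂₄ ∷ p₁₂≢p₃₄ ∷ [])
  ∷ (p₁₃≢p₁₄ ∷ p₁₃≢p₂₃ ∷ p₁₃≢p₂₄ ∷ p₁₃≢p₃₄ ∷ [])
  ∷ (p₁₄≢p₂₃ ∷ p₁₄≢p₂₄ ∷ p₁₄≢p₃₄ ∷ [])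
  ∷ (p₂₃≢p₂₄ ∷ p₂₃≢p₃₄ ∷ [])
  ∷ (p₂₄≢p₃₄ ∷ [])
  ∷ [] ∷ [] )
  p₁₄∤a₁ p₂₄∤a₂ p₃₄∤a₃ p₁₂∤gcd[a₁,a₂] p₁₃∤gcd[a₁,a₃] p₂₃∤gcd[a₂,a₃] n _ bound≤n =
  μ₁ , μ₂ , μ₃ , μ₄ , μ-positive , n≡Σaμ , gcd[μ]≡1 , pairwise-gcd>1
  where
  open Construction a₁ a₂ a₃ a₄ 0<a₁ 0<a₂ 0<a₃ gcd[a₁,a₂,a₃]≡1 pr₁₂ pr₁₃ pr₁₄ pr₂₃ pr₂₄ pr₃₄
    p₁₂≢p₁₃ p₁₂≢p₁₄ p₁₂≢p₂₃ p₁₂≢p₂₄ p₁₂≢p₃₄ p₁₃≢p₁₄ p₁₃≢p₂₃ p₁₃≢p₂₄ p₁₃≢p₃₄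
    p₁₄≢p₂₃ p₁₄≢p₂₄ p₁₄≢p₃₄ p₂₃≢p₂₄ p₂₃≢p₃₄ p₂₄≢p₃₄
    p₁₄∤a₁ p₂₄∤a₂ p₃₄∤a₃ p₁₂∤gcd[a₁,a₂] p₁₃∤gcd[a₁,a₃] p₂₃∤gcd[a₂,a₃] n bound≤n
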